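{- If $G$ is a chordal claw-free graph, then $\overrightarrow{\chi}(G)\leq \Delta(G)\leq 3\omega(G)$.
   Context: An orientation $D$ of a graph $G$ replaces each edge by exactly one of its two possible arcs; $d^-_D(v)$ is the indegree of $v$. $D$ is proper if adjacent vertices have distinct indegrees; a $k$-orientation has maximum indegree at most $k$. $\overrightarrow{\chi}(G)$ is the minimum $k$ such that $G$ admits a proper $k$-orientation; $\Delta(G)$ is the maximum degree and $\omega(G)$ the clique number. A graph is chordal if every cycle of length at least 4 has a chord; a claw is $K_{1,3}$ and claw-free means no induced claw. -}

module Defs where

open import Data.Nat using (ℕ; zero; suc; _+_; _*_; _≤_; _⊔_; _∸_)
open import Data.Fin using (Fin; toℕ)
open import Data.Fin.Subset using (Subset; _∈_; ∣_∣)
open import Data.Bool using (Bool; true; false; if_then_else_)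
open import Data.List using (List; map; allFin; foldr)
open import Data.Nat.ListAction using (sum)
open import Data.Product using (Σ; _×_; ∃)
open import Data.Sum using (_⊎_)
open import Relation.Nullary using (¬_)
open import Relation.Binary.PropositionalEquality using (_≡_; _≢_)
open import Function.Definitions using (Injective)

record Graph : Set where
  field
    n   : ℕ
    adj : Fin n → Fin n → Bool
    sym : ∀ u v → adj u v ≡ adj v u
    irr : ∀ v → adj v v ≡ false
open Graph public

Adj : (G : Graph) → Fin (n G) → Fin (n G) → Set
Adj G u v = adj G u v ≡ true

countTrue : ∀ {m} → (Fin m → Bool) → ℕ
countTrue {m} f = sum (map (λ u → if f u then 1 else 0) (allFin m))

degree : (G : Graph) → Fin (n G) → ℕ
degree G v = countTrue (λ u → adj G u v)

maxDegree : Graph → ℕ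
maxDegree G = foldr (λ v m → degree G v ⊔ m) 0 (allFin (n G))

-- An orientation: arc G u v = true means the edge uv is oriented u → v.
-- Each edge receives exactly one of its two arcs; non-edges receive none.
record Orientation (G : Graph) : Set where
  field
    arc       : Fin (n G) → Fin (n G) → Bool
    onEdges   : ∀ u v → arc u v ≡ true → Adj G u v
    exactlyOne : ∀ u v → Adj G u v →
                 (arc u v ≡ true × arc v u ≡ false) ⊎ (arc u v ≡ false × arc v u ≡ true)
open Orientation public

indegree : {G : Graph} → Orientation G → Fin (n G) → ℕ
indegree D v = countTrue (λ u → arc D u v)

IsProper : {G : Graph} → Orientation G → Set
IsProper {G} D = ∀ u v → Adj G u v → indegree D u ≢ indegree D v

IsKOrientation : {G : Graph} → ℕ → Orientation G → Set
IsKOrientation {G} k D = ∀ v → indegree D v ≤ k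

-- χ⃗(G) ≤ k  (χ⃗ is the least k admitting a proper k-orientation)
ProperOrientationNumber≤ : Graph → ℕ → Set
ProperOrientationNumber≤ G k = Σ (Orientation G) λ D → IsProper D × IsKOrientation k D

IsClique : (G : Graph) → Subset (n G) → Set
IsClique G S = ∀ u v → u ∈ S → v ∈ S → u ≢ v → Adj G u v

IsCliqueNumber : Graph → ℕ → Set
IsCliqueNumber G w =
  (Σ (Subset (n G)) λ S → IsClique G S × ∣ S ∣ ≡ w) ×
  (∀ S → IsClique G S → ∣ S ∣ ≤ w)

CyclicNext : ∀ {k} → Fin k → Fin k → Set
CyclicNext {k} i j = (toℕ j ≡ suc (toℕ i)) ⊎ (toℕ i ≡ k ∸ 1 × toℕ j ≡ 0)

record Cycle (G : Graph) (k : ℕ) : Set where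
  field
    vtx      : Fin k → Fin (n G)
    distinct : Injective _≡_ _≡_ vtx
    edges    : ∀ i j → CyclicNext i j → Adj G (vtx i) (vtx j)
open Cycle public

HasChord : {G : Graph} {k : ℕ} → Cycle G k → Set
HasChord {G} {k} C = Σ (Fin k) λ i → Σ (Fin k) λ j →
  i ≢ j × ¬ CyclicNext i j × ¬ CyclicNext j i × Adj G (vtx C i) (vtx C j)

Chordal : Graph → Set
Chordal G = ∀ k → 4 ≤ k → (C : Cycle G k) → HasChord C

InducedClaw : (G : Graph) → Fin (n G) → Fin (n G) → Fin (n G) → Fin (n G) → Set
InducedClaw G c a b d =
  Adj G c a × Adj G c b × Adj G c d ×
  a ≢ b × a ≢ d × b ≢ d ×
  ¬ Adj G a b × ¬ Adj G a d × ¬ Adj G b d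

ClawFree : Graph → Set
ClawFree G = ∀ c a b d → ¬ InducedClaw G c a b d

module Submission where

-- Reversing an arc a → c whose ends have the same indegree k gives them indegrees k + 1 and
-- k − 1 and fixes all other indegrees, so the potential Σ d⁻(v)² rises by exactly 2. The
-- potential is bounded, hence repeated reversal from any orientation ends in a proper one, and
-- indegrees never exceed degrees: χ⃗(G) ≤ Δ(G) holds for every graph.
--
-- If the neighbourhood of v is not a clique, pick non-adjacent neighbours b₁ and b₂. Every
-- neighbour of v misses b₁, misses b₂, or is adjacent to both. Two neighbours missing the same
-- bᵢ are adjacent, since otherwise they form a claw at v together with bᵢ; two neighbours x, y
-- of both are adjacent, since otherwise b₁ x b₂ y is a chordless 4-cycle. So deg v ≤ 3ω.

open import Defs hiding (sym)
open import Data.Bool using (Bool; true; false; if_then_else_; _∧_; _∨_)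
open import Data.Bool.Properties using (∧-comm; ∨-comm; ∧-conicalˡ) renaming (_≟_ to _≟ᵇ_)
open import Data.Empty using (⊥-elim)
open import Data.Fin using (Fin; zero; suc; _≟_; _<?_)
open import Data.Fin.Patterns using (0F; 1F; 2F; 3F)
open import Data.Fin.Properties using (any?; <-cmp; toℕ-injective)
import Data.Fin.Properties as Finₚ
open import Data.Fin.Subset using (∣_∣) renaming (_∈_ to _∈ₛ_)
open import Data.List using ([]; _∷_; allFin; map; foldr)
open import Data.List.Membership.Propositional using (_∈_)
open import Data.List.Relation.Unary.Any using (here; there)
open import Data.List.Properties using (map-tabulate; map-cong)
open import Data.List.Membership.Propositional.Properties using (∈-allFin)
open import Data.Nat using (ℕ; zero; suc; _+_; _*_; _∸_; _≤_; _<_; _⊔_; z≤n; s≤s; z<s; s≤s⁻¹)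
open import Data.Nat.ListAction using (sum)
open import Data.Nat.Properties
  using (≤-refl; ≤-trans; ≤-reflexive; +-mono-≤; *-mono-≤; +-assoc; +-comm; +-identityʳ; *-identityʳ;
         m≤n+m; m≤n*m; +-monoʳ-≤; m≤m⊔n; m≤n⊔m; ⊔-lub; +-cancelʳ-≡; m<m+n; <-≤-trans;
         ∸-monoʳ-<; m∸n≤m; module ≤-Reasoning)
  renaming (_≟_ to _≟ℕ_)
open import Data.Nat.Tactic.RingSolver using (solve-∀)
open import Data.Product using (Σ; _×_; _,_; proj₁; proj₂; ∃₂)
open import Data.Sum using (_⊎_; inj₁; inj₂)
import Data.Sum as Sum
open import Data.Vec using (tabulate)
import Data.Vec as Vec
open import Data.Vec.Properties using ([]=⇒lookup; lookup∘tabulate)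
open import Function using (_∘_)
open import Relation.Binary.Definitions using (tri<; tri≈; tri>)
open import Relation.Binary.PropositionalEquality
open import Relation.Nullary using (¬_; Dec; yes; no; does)
open import Relation.Nullary.Decidable using (dec-true; dec-false; _×-dec_; _⊎-dec_; ¬?)

∑ : ∀ {m} → (Fin m → ℕ) → ℕ
∑ {m} g = sum (map g (allFin m))

∑-suc : ∀ {m} (g : Fin (suc m) → ℕ) → ∑ g ≡ g zero + ∑ (g ∘ suc)
∑-suc {m} g = cong (λ gs → g zero + sum gs)
  (trans (map-tabulate suc g) (sym (map-tabulate (λ i → i) (g ∘ suc))))

∑-cong : ∀ {m} {f g : Fin m → ℕ} → (∀ x → f x ≡ g x) → ∑ f ≡ ∑ g
∑-cong {m} f≗g = cong sum (map-cong f≗g (allFin m))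

∑-mono-≤ : ∀ {m} {f g : Fin m → ℕ} → (∀ x → f x ≤ g x) → ∑ f ≤ ∑ g
∑-mono-≤ {zero} f≤g = z≤n
∑-mono-≤ {suc m} {f} {g} f≤g rewrite ∑-suc f | ∑-suc g =
  +-mono-≤ (f≤g zero) (∑-mono-≤ (f≤g ∘ suc))

∑-bounded : ∀ {m} {f : Fin m → ℕ} c → (∀ x → f x ≤ c) → ∑ f ≤ m * c
∑-bounded {zero} c f≤c = z≤n
∑-bounded {suc m} {f} c f≤c rewrite ∑-suc f = +-mono-≤ (f≤c zero) (∑-bounded c (f≤c ∘ suc))

∑-+ : ∀ {m} (f g : Fin m → ℕ) → ∑ (λ x → f x + g x) ≡ ∑ f + ∑ g
∑-+ {zero} f g = refl
∑-+ {suc m} f g rewrite ∑-suc (λ x → f x + g x) | ∑-suc f | ∑-suc g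
                      | ∑-+ (f ∘ suc) (g ∘ suc) = interchange (f zero) (g zero) _ _
  where
  interchange : ∀ a b c d → a + b + (c + d) ≡ a + c + (b + d)
  interchange = solve-∀

∑-except : ∀ {m} {f g : Fin m → ℕ} p → (∀ x → x ≢ p → f x ≡ g x) → ∑ f + g p ≡ ∑ g + f p
∑-except {suc m} {f} {g} zero f≗g = begin
  ∑ f + g zero                  ≡⟨ cong (_+ g zero) (∑-suc f) ⟩
  f zero + ∑ (f ∘ suc) + g zero ≡⟨ cong (λ s → f zero + s + g zero) (∑-cong λ x → f≗g (suc x) λ ()) ⟩
  f zero + ∑ (g ∘ suc) + g zero ≡⟨ swap-ends (f zero) _ _ ⟩
  g zero + ∑ (g ∘ suc) + f zero ≡⟨ cong (_+ f zero) (∑-suc g) ⟨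
  ∑ g + f zero                  ∎
  where
  open ≡-Reasoning
  swap-ends : ∀ a b c → a + b + c ≡ c + b + a
  swap-ends = solve-∀
∑-except {suc m} {f} {g} (suc p) f≗g = begin
  ∑ f + g (suc p)                    ≡⟨ cong (_+ g (suc p)) (∑-suc f) ⟩
  f zero + ∑ (f ∘ suc) + g (suc p)   ≡⟨ +-assoc (f zero) _ _ ⟩
  f zero + (∑ (f ∘ suc) + g (suc p)) ≡⟨ cong₂ _+_ (f≗g zero (λ ()))
    (∑-except p (λ x x≢p → f≗g (suc x) (x≢p ∘ Finₚ.suc-injective))) ⟩
  g zero + (∑ (g ∘ suc) + f (suc p)) ≡⟨ +-assoc (g zero) _ _ ⟨
  g zero + ∑ (g ∘ suc) + f (suc p)   ≡⟨ cong (_+ f (suc p)) (∑-suc g) ⟨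
  ∑ g + f (suc p)                    ∎
  where open ≡-Reasoning

∑-except₂ : ∀ {m} {f g : Fin m → ℕ} p q → p ≢ q → (∀ x → x ≢ p → x ≢ q → f x ≡ g x) →
            ∑ f + g p + g q ≡ ∑ g + f p + f q
∑-except₂ {m} {f} {g} p q p≢q f≗g = begin
  ∑ f + g p + g q ≡⟨ cong (λ s → ∑ f + s + g q) h-at-p ⟨
  ∑ f + h p + g q ≡⟨ cong (_+ g q) (∑-except p f≗h) ⟩
  ∑ h + f p + g q ≡⟨ swap-last (∑ h) _ _ ⟩
  ∑ h + g q + f p ≡⟨ cong (_+ f p) (∑-except q h≗g) ⟩
  ∑ g + h q + f p ≡⟨ cong (λ s → ∑ g + s + f p) h-at-q ⟩
  ∑ g + f q + f p ≡⟨ swap-last (∑ g) _ _ ⟩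
  ∑ g + f p + f q ∎
  where
  open ≡-Reasoning
  h : Fin m → ℕ
  h x = if does (x ≟ p) then g x else f x
  h-at-p : h p ≡ g p
  h-at-p rewrite dec-true (p ≟ p) refl = refl
  h-at-q : h q ≡ f q
  h-at-q rewrite dec-false (q ≟ p) (p≢q ∘ sym) = refl
  f≗h : ∀ x → x ≢ p → f x ≡ h x
  f≗h x x≢p rewrite dec-false (x ≟ p) x≢p = refl
  h≗g : ∀ x → x ≢ q → h x ≡ g x
  h≗g x x≢q with x ≟ p
  ... | yes _   = refl
  ... | no  x≢p = f≗g x x≢p x≢q
  swap-last : ∀ a b c → a + b + c ≡ a + c + b
  swap-last = solve-∀

indicator : Bool → ℕ
indicator b = if b then 1 else 0

countTrue-mono : ∀ {m} {f g : Fin m → Bool} → (∀ x → f x ≡ true → g x ≡ true) →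
                 countTrue f ≤ countTrue g
countTrue-mono {f = f} {g} f⊆g = ∑-mono-≤ (λ x → pointwise (f x) (g x) (f⊆g x))
  where
  pointwise : ∀ a b → (a ≡ true → b ≡ true) → indicator a ≤ indicator b
  pointwise false b a⊆b = z≤n
  pointwise true  b a⊆b rewrite a⊆b refl = ≤-refl

countTrue≤size : ∀ {m} (f : Fin m → Bool) → countTrue f ≤ m
countTrue≤size {m} f = ≤-trans (∑-bounded 1 (λ x → indicator≤1 (f x))) (≤-reflexive (*-identityʳ m))
  where
  indicator≤1 : ∀ b → indicator b ≤ 1
  indicator≤1 false = z≤n
  indicator≤1 true  = ≤-refl

countTrue-∪ : ∀ {m} {f g h : Fin m → Bool} → (∀ x → h x ≡ true → f x ≡ true ⊎ g x ≡ true) →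
              countTrue h ≤ countTrue f + countTrue g
countTrue-∪ {f = f} {g} {h} h⊆f∪g = begin
  countTrue h                               ≤⟨ ∑-mono-≤ (λ x → pointwise (h x) (f x) (g x) (h⊆f∪g x)) ⟩
  ∑ (λ x → indicator (f x) + indicator (g x)) ≡⟨ ∑-+ (indicator ∘ f) (indicator ∘ g) ⟩
  countTrue f + countTrue g                 ∎
  where
  open ≤-Reasoning
  pointwise : ∀ c a b → (c ≡ true → a ≡ true ⊎ b ≡ true) → indicator c ≤ indicator a + indicator b
  pointwise false a b _ = z≤n
  pointwise true  a b c⊆a∪b with c⊆a∪b refl
  ... | inj₁ refl = s≤s z≤n
  ... | inj₂ refl = m≤n+m 1 (indicator a)

countTrue-except : ∀ {m} {f g : Fin m → Bool} p → (∀ x → x ≢ p → f x ≡ g x) →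
                   countTrue f + indicator (g p) ≡ countTrue g + indicator (f p)
countTrue-except p f≗g = ∑-except p (λ x x≢p → cong indicator (f≗g x x≢p))

count : ∀ {m} {P : Fin m → Set} → (∀ x → Dec (P x)) → ℕ
count P? = countTrue (λ x → does (P? x))

does-true : ∀ {A : Set} (d : Dec A) → does d ≡ true → A
does-true (yes a) _ = a

foldr-⊔-upper : ∀ {A : Set} (f : A → ℕ) {x xs} → x ∈ xs → f x ≤ foldr (λ y m → f y ⊔ m) 0 xs
foldr-⊔-upper f (here refl) = m≤m⊔n _ _
foldr-⊔-upper f (there x∈xs) = ≤-trans (foldr-⊔-upper f x∈xs) (m≤n⊔m _ _)

foldr-⊔-least : ∀ {A : Set} (f : A → ℕ) {c} xs → (∀ x → f x ≤ c) → foldr (λ y m → f y ⊔ m) 0 xs ≤ c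
foldr-⊔-least f []       f≤c = z≤n
foldr-⊔-least f (x ∷ xs) f≤c = ⊔-lub (f≤c x) (foldr-⊔-least f xs f≤c)

sameEdge : ∀ {k} → Fin k → Fin k → Fin k → Fin k → Bool
sameEdge a c x y = does ((x ≟ a) ×-dec (y ≟ c)) ∨ does ((x ≟ c) ×-dec (y ≟ a))

sameEdge-sym : ∀ {k} (a c x y : Fin k) → sameEdge a c x y ≡ sameEdge a c y x
sameEdge-sym a c x y = trans (∨-comm (does (x ≟ a) ∧ does (y ≟ c)) _)
  (cong₂ _∨_ (∧-comm (does (x ≟ c)) _) (∧-comm (does (x ≟ a)) _))

sameEdge-refl : ∀ {k} (a c : Fin k) → sameEdge a c a c ≡ true
sameEdge-refl a c rewrite dec-true ((a ≟ a) ×-dec (c ≟ c)) (refl , refl) = refl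

sameEdge-other : ∀ {k} {a c x y : Fin k} → ¬ (x ≡ a × y ≡ c) → ¬ (x ≡ c × y ≡ a) → sameEdge a c x y ≡ false
sameEdge-other {a = a} {c} {x} {y} ¬ac ¬ca
  rewrite dec-false ((x ≟ a) ×-dec (y ≟ c)) ¬ac | dec-false ((x ≟ c) ×-dec (y ≟ a)) ¬ca = refl

square : ℕ → ℕ
square k = k * k

square-balance : ∀ P P′ j → P + square (2 + j) + square j ≡ P′ + square (1 + j) + square (1 + j) →
                 P′ ≡ P + 2
square-balance P P′ j e = sym (+-cancelʳ-≡ (square (1 + j) + square (1 + j)) (P + 2) P′ (begin
  P + 2 + (square (1 + j) + square (1 + j)) ≡⟨ expand P j ⟩
  P + square (2 + j) + square j             ≡⟨ e ⟩
  P′ + square (1 + j) + square (1 + j)      ≡⟨ +-assoc P′ _ _ ⟩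
  P′ + (square (1 + j) + square (1 + j))    ∎))
  where
  open ≡-Reasoning
  expand : ∀ P j → P + 2 + ((1 + j) * (1 + j) + (1 + j) * (1 + j)) ≡ P + (2 + j) * (2 + j) + j * j
  expand = solve-∀

∣tabulate∣≡countTrue : ∀ {m} (f : Fin m → Bool) → ∣ tabulate f ∣ ≡ countTrue f
∣tabulate∣≡countTrue {zero}  f = refl
∣tabulate∣≡countTrue {suc m} f = trans (head (f zero)) (sym (∑-suc (indicator ∘ f)))
  where
  head : ∀ b → ∣ b Vec.∷ tabulate (f ∘ suc) ∣ ≡ indicator b + countTrue (f ∘ suc)
  head true  = cong suc (∣tabulate∣≡countTrue (f ∘ suc))
  head false = ∣tabulate∣≡countTrue (f ∘ suc)

∈-tabulate⁻ : ∀ {m} (f : Fin m → Bool) {x} → x ∈ₛ tabulate f → f x ≡ true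
∈-tabulate⁻ f {x} x∈ = trans (sym (lookup∘tabulate f x)) ([]=⇒lookup x∈)

module _ {G : Graph} where

  Adj-sym : ∀ {u v} → Adj G u v → Adj G v u
  Adj-sym {u} {v} uv = trans (Graph.sym G v u) uv

  Adj⇒≢ : ∀ {u v} → Adj G u v → u ≢ v
  Adj⇒≢ {u} uv refl with trans (sym uv) (irr G u)
  ... | ()

  Adj? : ∀ u v → Dec (Adj G u v)
  Adj? u v = adj G u v ≟ᵇ true

  degree≤maxDegree : ∀ v → degree G v ≤ maxDegree G
  degree≤maxDegree v = foldr-⊔-upper (degree G) (∈-allFin v)

  arc-antisym : (D : Orientation G) {a c : Fin (n G)} → arc D a c ≡ true → arc D c a ≡ false
  arc-antisym D {a} {c} ac with exactlyOne D a c (onEdges D a c ac)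
  ... | inj₁ (_ , ca)  = ca
  ... | inj₂ (ac′ , _) with trans (sym ac) ac′
  ...   | ()

  indegree≤degree : (D : Orientation G) → ∀ v → indegree D v ≤ degree G v
  indegree≤degree D v = countTrue-mono (λ u → onEdges D u v)

  byIndex : Orientation G
  byIndex = record
    { arc        = λ u v → adj G u v ∧ does (u <? v)
    ; onEdges    = λ u v → ∧-conicalˡ _ _
    ; exactlyOne = exactlyOne′
    }
    where
    exactlyOne′ : ∀ u v → Adj G u v →
      (adj G u v ∧ does (u <? v) ≡ true × adj G v u ∧ does (v <? u) ≡ false) ⊎
      (adj G u v ∧ does (u <? v) ≡ false × adj G v u ∧ does (v <? u) ≡ true)
    exactlyOne′ u v uv rewrite uv | Adj-sym uv with <-cmp u v
    ... | tri< u<v _ v≮u = inj₁ (dec-true (u <? v) u<v , dec-false (v <? u) v≮u)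
    ... | tri≈ _ u≡v _   = ⊥-elim (Adj⇒≢ uv u≡v)
    ... | tri> u≮v _ v<u = inj₂ (dec-false (u <? v) u≮v , dec-true (v <? u) v<u)

  reverseOn : (R : Fin (n G) → Fin (n G) → Bool) → (∀ x y → R x y ≡ R y x) →
              Orientation G → Orientation G
  reverseOn R R-sym D = record
    { arc        = arc′
    ; onEdges    = onEdges′
    ; exactlyOne = exactlyOne′
    }
    where
    arc′ : Fin (n G) → Fin (n G) → Bool
    arc′ x y = if R x y then arc D y x else arc D x y
    onEdges′ : ∀ x y → arc′ x y ≡ true → Adj G x y
    onEdges′ x y with R x y
    ... | true  = Adj-sym ∘ onEdges D y x
    ... | false = onEdges D x y
    exactlyOne′ : ∀ x y → Adj G x y →
      (arc′ x y ≡ true × arc′ y x ≡ false) ⊎ (arc′ x y ≡ false × arc′ y x ≡ true)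
    exactlyOne′ x y xy rewrite R-sym y x with R x y
    ... | true  = exactlyOne D y x (Adj-sym xy)
    ... | false = exactlyOne D x y xy

  reverseArc : Orientation G → Fin (n G) → Fin (n G) → Orientation G
  reverseArc D a c = reverseOn (sameEdge a c) (sameEdge-sym a c) D

  module _ (D : Orientation G) {a c : Fin (n G)} where

    reverseArc-ac : arc (reverseArc D a c) a c ≡ arc D c a
    reverseArc-ac rewrite sameEdge-refl a c = refl

    reverseArc-ca : arc (reverseArc D a c) c a ≡ arc D a c
    reverseArc-ca rewrite sameEdge-sym a c c a | sameEdge-refl a c = refl

    reverseArc-other : ∀ {x y} → ¬ (x ≡ a × y ≡ c) → ¬ (x ≡ c × y ≡ a) →
                       arc (reverseArc D a c) x y ≡ arc D x y
    reverseArc-other ¬ac ¬ca rewrite sameEdge-other ¬ac ¬ca = refl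

    indegree-reverseArc-other : ∀ {w} → w ≢ a → w ≢ c → indegree (reverseArc D a c) w ≡ indegree D w
    indegree-reverseArc-other {w} w≢a w≢c = ∑-cong λ x →
      cong indicator (reverseArc-other {x} {w} (w≢c ∘ proj₂) (w≢a ∘ proj₂))

    module _ (ac : arc D a c ≡ true) where

      private
        a≢c : a ≢ c
        a≢c = Adj⇒≢ (onEdges D a c ac)

        gains-one : ∀ {k k′} → k + 1 ≡ k′ + 0 → k′ ≡ suc k
        gains-one {k} {k′} e = trans (sym (+-identityʳ k′)) (trans (sym e) (+-comm k 1))

      indegree-reverseArc-head : indegree D c ≡ suc (indegree (reverseArc D a c) c)
      indegree-reverseArc-head = gains-one
        (subst₂ (λ s t → indegree (reverseArc D a c) c + indicator s ≡ indegree D c + indicator t)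
          ac (trans reverseArc-ac (arc-antisym D ac))
          (countTrue-except a λ x x≢a → reverseArc-other (x≢a ∘ proj₁) (a≢c ∘ sym ∘ proj₂)))

      indegree-reverseArc-tail : indegree (reverseArc D a c) a ≡ suc (indegree D a)
      indegree-reverseArc-tail = gains-one
        (subst₂ (λ s t → indegree D a + indicator s ≡ indegree (reverseArc D a c) a + indicator t)
          (trans reverseArc-ca ac) (arc-antisym D ac)
          (countTrue-except c λ x x≢c → sym (reverseArc-other (a≢c ∘ proj₂) (x≢c ∘ proj₁))))

  potential : Orientation G → ℕ
  potential D = ∑ λ v → square (indegree D v)

  maxPotential : ℕ
  maxPotential = n G * square (n G)

  potential≤ : ∀ D → potential D ≤ maxPotential
  potential≤ D = ∑-bounded (square (n G)) λ v →
    *-mono-≤ (countTrue≤size (λ u → arc D u v)) (countTrue≤size (λ u → arc D u v))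

  potential-reverseArc : (D : Orientation G) {a c : Fin (n G)} (ac : arc D a c ≡ true) →
                         indegree D a ≡ indegree D c → potential (reverseArc D a c) ≡ potential D + 2
  potential-reverseArc D {a} {c} ac a≈c = square-balance (potential D) (potential D′) j (begin
    potential D + square (2 + j) + square j                       ≡⟨ cong (λ k → potential D + square k + square j) in′a ⟨
    potential D + square (indegree D′ a) + square (indegree D′ c) ≡⟨ ∑-except₂ a c a≢c unchanged ⟩
    potential D′ + square (indegree D a) + square (indegree D c)  ≡⟨ cong₂ (λ s t → potential D′ + square s + square t) ina inc ⟩
    potential D′ + square (1 + j) + square (1 + j)                ∎)
    where
    open ≡-Reasoning
    D′ : Orientation G
    D′ = reverseArc D a c
    j : ℕ
    j = indegree D′ c
    a≢c : a ≢ c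
    a≢c = Adj⇒≢ (onEdges D a c ac)
    inc : indegree D c ≡ 1 + j
    inc = indegree-reverseArc-head D ac
    ina : indegree D a ≡ 1 + j
    ina = trans a≈c inc
    in′a : indegree D′ a ≡ 2 + j
    in′a = trans (indegree-reverseArc-tail D ac) (cong suc ina)
    unchanged : ∀ x → x ≢ a → x ≢ c → square (indegree D x) ≡ square (indegree D′ x)
    unchanged x x≢a x≢c = cong square (sym (indegree-reverseArc-other D x≢a x≢c))

  monochromaticArc : (D : Orientation G) {u v : Fin (n G)} → Adj G u v → indegree D u ≡ indegree D v →
                     ∃₂ λ a c → arc D a c ≡ true × indegree D a ≡ indegree D c
  monochromaticArc D {u} {v} uv u≈v with exactlyOne D u v uv
  ... | inj₁ (uv′ , _) = u , v , uv′ , u≈v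
  ... | inj₂ (_ , vu′) = v , u , vu′ , sym u≈v

  conflictingEdge? : (D : Orientation G) → Dec (∃₂ λ u v → Adj G u v × indegree D u ≡ indegree D v)
  conflictingEdge? D = any? λ u → any? λ v → Adj? u v ×-dec (indegree D u ≟ℕ indegree D v)

  proper-by-descent : ∀ fuel D → maxPotential ∸ potential D < fuel → Σ (Orientation G) IsProper
  proper-by-descent (suc fuel) D gap with conflictingEdge? D
  ... | no noConflict = D , λ u v uv u≈v → noConflict (u , v , uv , u≈v)
  ... | yes (u , v , uv , u≈v) with monochromaticArc D uv u≈v
  ...   | a , c , ac , a≈c = proper-by-descent fuel (reverseArc D a c) (<-≤-trans shrinks (s≤s⁻¹ gap))
    where
    increases : potential D < potential (reverseArc D a c)
    increases = subst (potential D <_) (sym (potential-reverseArc D ac a≈c)) (m<m+n _ z<s)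
    shrinks : maxPotential ∸ potential (reverseArc D a c) < maxPotential ∸ potential D
    shrinks = ∸-monoʳ-< increases (potential≤ (reverseArc D a c))

  properOrientation : Σ (Orientation G) IsProper
  properOrientation = proper-by-descent (suc maxPotential) byIndex (s≤s (m∸n≤m _ (potential byIndex)))

  properOrientationNumber≤maxDegree : ProperOrientationNumber≤ G (maxDegree G)
  properOrientationNumber≤maxDegree =
    let D , proper = properOrientation
    in D , proper , λ v → ≤-trans (indegree≤degree D v) (degree≤maxDegree v)


  countTrue≤cliqueNumber : ∀ {w} → IsCliqueNumber G w → (f : Fin (n G) → Bool) →
    (∀ x y → f x ≡ true → f y ≡ true → x ≢ y → Adj G x y) → countTrue f ≤ w
  countTrue≤cliqueNumber {w} ω f clique = subst (_≤ w) (∣tabulate∣≡countTrue f)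
    (proj₂ ω (tabulate f) λ x y x∈ y∈ → clique x y (∈-tabulate⁻ f x∈) (∈-tabulate⁻ f y∈))

  count≤cliqueNumber : ∀ {w} → IsCliqueNumber G w → {P : Fin (n G) → Set} (P? : ∀ x → Dec (P x)) →
    (∀ x y → P x → P y → x ≢ y → Adj G x y) → count P? ≤ w
  count≤cliqueNumber ω P? clique = countTrue≤cliqueNumber ω _ λ x y Px Py →
    clique x y (does-true (P? x) Px) (does-true (P? y) Py)

  chordal⇒4-cycle-chord : Chordal G → ∀ {p q r s} → p ≢ r → q ≢ s →
    Adj G p q → Adj G q r → Adj G r s → Adj G s p → Adj G p r ⊎ Adj G q s
  chordal⇒4-cycle-chord chordal {p} {q} {r} {s} p≢r q≢s pq qr rs sp =
    diagonal (chordal 4 ≤-refl cycle)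
    where
    corner : Fin 4 → Fin (n G)
    corner 0F = p
    corner 1F = q
    corner 2F = r
    corner 3F = s

    side : ∀ i j → CyclicNext i j → Adj G (corner i) (corner j)
    side 0F j (inj₁ j≡1) with toℕ-injective {j = 1F} j≡1
    ... | refl = pq
    side 1F j (inj₁ j≡2) with toℕ-injective {j = 2F} j≡2
    ... | refl = qr
    side 2F j (inj₁ j≡3) with toℕ-injective {j = 3F} j≡3
    ... | refl = rs
    side 3F 0F (inj₁ ())
    side 3F 1F (inj₁ ())
    side 3F 2F (inj₁ ())
    side 3F 3F (inj₁ ())
    side i j (inj₂ (i≡3 , j≡0)) with toℕ-injective {j = 3F} i≡3 | toℕ-injective {j = 0F} j≡0
    ... | refl | refl = sp

    corner-injective : ∀ {i j} → corner i ≡ corner j → i ≡ j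
    corner-injective {0F} {0F} _ = refl
    corner-injective {0F} {1F} e = ⊥-elim (Adj⇒≢ pq e)
    corner-injective {0F} {2F} e = ⊥-elim (p≢r e)
    corner-injective {0F} {3F} e = ⊥-elim (Adj⇒≢ sp (sym e))
    corner-injective {1F} {0F} e = ⊥-elim (Adj⇒≢ pq (sym e))
    corner-injective {1F} {1F} _ = refl
    corner-injective {1F} {2F} e = ⊥-elim (Adj⇒≢ qr e)
    corner-injective {1F} {3F} e = ⊥-elim (q≢s e)
    corner-injective {2F} {0F} e = ⊥-elim (p≢r (sym e))
    corner-injective {2F} {1F} e = ⊥-elim (Adj⇒≢ qr (sym e))
    corner-injective {2F} {2F} _ = refl
    corner-injective {2F} {3F} e = ⊥-elim (Adj⇒≢ rs e)
    corner-injective {3F} {0F} e = ⊥-elim (Adj⇒≢ sp e)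
    corner-injective {3F} {1F} e = ⊥-elim (q≢s (sym e))
    corner-injective {3F} {2F} e = ⊥-elim (Adj⇒≢ rs (sym e))
    corner-injective {3F} {3F} _ = refl

    cycle : Cycle G 4
    cycle = record { vtx = corner ; distinct = corner-injective ; edges = side }

    diagonal : HasChord cycle → Adj G p r ⊎ Adj G q s
    diagonal (0F , 0F , i≢j , _ , _ , _) = ⊥-elim (i≢j refl)
    diagonal (0F , 1F , _ , ¬next , _ , _) = ⊥-elim (¬next (inj₁ refl))
    diagonal (0F , 2F , _ , _ , _ , pr) = inj₁ pr
    diagonal (0F , 3F , _ , _ , ¬next , _) = ⊥-elim (¬next (inj₂ (refl , refl)))
    diagonal (1F , 0F , _ , _ , ¬next , _) = ⊥-elim (¬next (inj₁ refl))
    diagonal (1F , 1F , i≢j , _ , _ , _) = ⊥-elim (i≢j refl)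
    diagonal (1F , 2F , _ , ¬next , _ , _) = ⊥-elim (¬next (inj₁ refl))
    diagonal (1F , 3F , _ , _ , _ , qs) = inj₂ qs
    diagonal (2F , 0F , _ , _ , _ , rp) = inj₁ (Adj-sym rp)
    diagonal (2F , 1F , _ , _ , ¬next , _) = ⊥-elim (¬next (inj₁ refl))
    diagonal (2F , 2F , i≢j , _ , _ , _) = ⊥-elim (i≢j refl)
    diagonal (2F , 3F , _ , ¬next , _ , _) = ⊥-elim (¬next (inj₁ refl))
    diagonal (3F , 0F , _ , ¬next , _ , _) = ⊥-elim (¬next (inj₂ (refl , refl)))
    diagonal (3F , 1F , _ , _ , _ , sq) = inj₂ (Adj-sym sq)
    diagonal (3F , 2F , _ , _ , ¬next , _) = ⊥-elim (¬next (inj₁ refl))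
    diagonal (3F , 3F , i≢j , _ , _ , _) = ⊥-elim (i≢j refl)

  module _ (v : Fin (n G)) where

    Avoider : Fin (n G) → Fin (n G) → Set
    Avoider b x = Adj G x v × ¬ Adj G x b × x ≢ b

    CommonNeighbour : Fin (n G) → Fin (n G) → Fin (n G) → Set
    CommonNeighbour b₁ b₂ x = Adj G x v × Adj G x b₁ × Adj G x b₂

    Avoider? : ∀ b x → Dec (Avoider b x)
    Avoider? b x = Adj? x v ×-dec ¬? (Adj? x b) ×-dec ¬? (x ≟ b)

    CommonNeighbour? : ∀ b₁ b₂ x → Dec (CommonNeighbour b₁ b₂ x)
    CommonNeighbour? b₁ b₂ x = Adj? x v ×-dec Adj? x b₁ ×-dec Adj? x b₂

    neighbourhood-cover : ∀ {b₁ b₂ x} → ¬ Adj G b₁ b₂ → b₁ ≢ b₂ → Adj G x v →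
      Avoider b₁ x ⊎ Avoider b₂ x ⊎ CommonNeighbour b₁ b₂ x
    neighbourhood-cover {b₁} {b₂} {x} ¬b₁b₂ b₁≢b₂ xv with Adj? x b₁ | Adj? x b₂ | x ≟ b₁
    ... | yes xb₁ | yes xb₂ | _       = inj₂ (inj₂ (xv , xb₁ , xb₂))
    ... | yes xb₁ | no ¬xb₂ | _       = inj₂ (inj₁ (xv , ¬xb₂ , λ { refl → ¬b₁b₂ (Adj-sym xb₁) }))
    ... | no ¬xb₁ | _       | no x≢b₁ = inj₁ (xv , ¬xb₁ , x≢b₁)
    ... | no _    | _       | yes refl = inj₂ (inj₁ (xv , ¬b₁b₂ , b₁≢b₂))

    avoiders-clique : ClawFree G → ∀ {b} → Adj G b v → ∀ x y → Avoider b x → Avoider b y → x ≢ y → Adj G x y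
    avoiders-clique clawFree {b} bv x y (xv , ¬xb , x≢b) (yv , ¬yb , y≢b) x≢y with Adj? x y
    ... | yes xy = xy
    ... | no ¬xy = ⊥-elim (clawFree v b x y (Adj-sym bv , Adj-sym xv , Adj-sym yv ,
                                             x≢b ∘ sym , y≢b ∘ sym , x≢y , ¬xb ∘ Adj-sym , ¬yb ∘ Adj-sym , ¬xy))

    commonNeighbours-clique : Chordal G → ∀ {b₁ b₂} → ¬ Adj G b₁ b₂ → b₁ ≢ b₂ →
      ∀ x y → CommonNeighbour b₁ b₂ x → CommonNeighbour b₁ b₂ y → x ≢ y → Adj G x y
    commonNeighbours-clique chordal ¬b₁b₂ b₁≢b₂ x y (_ , xb₁ , xb₂) (_ , yb₁ , yb₂) x≢y
      with chordal⇒4-cycle-chord chordal b₁≢b₂ x≢y (Adj-sym xb₁) xb₂ (Adj-sym yb₂) yb₁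
    ... | inj₁ b₁b₂ = ⊥-elim (¬b₁b₂ b₁b₂)
    ... | inj₂ xy   = xy

    nonadjacentNeighbours? : Dec (∃₂ λ b₁ b₂ → Adj G b₁ v × Adj G b₂ v × b₁ ≢ b₂ × ¬ Adj G b₁ b₂)
    nonadjacentNeighbours? = any? λ b₁ → any? λ b₂ →
      Adj? b₁ v ×-dec Adj? b₂ v ×-dec ¬? (b₁ ≟ b₂) ×-dec ¬? (Adj? b₁ b₂)

    module _ (chordal : Chordal G) (clawFree : ClawFree G) {w : ℕ} (ω : IsCliqueNumber G w) where

      degree≤3ω-split : ∀ {b₁ b₂} → Adj G b₁ v → Adj G b₂ v → b₁ ≢ b₂ → ¬ Adj G b₁ b₂ → degree G v ≤ 3 * w
      degree≤3ω-split {b₁} {b₂} b₁v b₂v b₁≢b₂ ¬b₁b₂ = begin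
        degree G v                                                   ≤⟨ countTrue-∪ cover ⟩
        count (Avoider? b₁) + count Rest?                            ≤⟨ +-monoʳ-≤ _ (countTrue-∪ split) ⟩
        count (Avoider? b₁) + (count (Avoider? b₂) + count Common?) ≤⟨ +-mono-≤ bound₁ (+-mono-≤ bound₂ bound₃) ⟩
        w + (w + w)                                                  ≡⟨ cong (λ t → w + (w + t)) (+-identityʳ w) ⟨
        3 * w                                                        ∎
        where
        open ≤-Reasoning
        Common? : ∀ x → Dec (CommonNeighbour b₁ b₂ x)
        Common? = CommonNeighbour? b₁ b₂
        Rest? : ∀ x → Dec (Avoider b₂ x ⊎ CommonNeighbour b₁ b₂ x)
        Rest? x = Avoider? b₂ x ⊎-dec Common? x
        cover : ∀ x → Adj G x v → does (Avoider? b₁ x) ≡ true ⊎ does (Rest? x) ≡ true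
        cover x xv = Sum.map (dec-true (Avoider? b₁ x)) (dec-true (Rest? x)) (neighbourhood-cover ¬b₁b₂ b₁≢b₂ xv)
        split : ∀ x → does (Rest? x) ≡ true → does (Avoider? b₂ x) ≡ true ⊎ does (Common? x) ≡ true
        split x e = Sum.map (dec-true (Avoider? b₂ x)) (dec-true (Common? x)) (does-true (Rest? x) e)
        bound₁ : count (Avoider? b₁) ≤ w
        bound₁ = count≤cliqueNumber ω (Avoider? b₁) (avoiders-clique clawFree b₁v)
        bound₂ : count (Avoider? b₂) ≤ w
        bound₂ = count≤cliqueNumber ω (Avoider? b₂) (avoiders-clique clawFree b₂v)
        bound₃ : count Common? ≤ w
        bound₃ = count≤cliqueNumber ω Common? (commonNeighbours-clique chordal ¬b₁b₂ b₁≢b₂)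

      degree≤3ω : degree G v ≤ 3 * w
      degree≤3ω with nonadjacentNeighbours?
      ... | yes (b₁ , b₂ , b₁v , b₂v , b₁≢b₂ , ¬b₁b₂) = degree≤3ω-split b₁v b₂v b₁≢b₂ ¬b₁b₂
      ... | no none = ≤-trans (countTrue≤cliqueNumber ω (λ u → adj G u v) neighbours-clique) (m≤n*m w 3)
        where
        neighbours-clique : ∀ x y → Adj G x v → Adj G y v → x ≢ y → Adj G x y
        neighbours-clique x y xv yv x≢y with Adj? x y
        ... | yes xy  = xy
        ... | no ¬xy = ⊥-elim (none (x , y , xv , yv , x≢y , ¬xy))

  maxDegree≤3ω : Chordal G → ClawFree G → ∀ {w} → IsCliqueNumber G w → maxDegree G ≤ 3 * w
  maxDegree≤3ω chordal clawFree ω = foldr-⊔-least (degree G) (allFin (n G)) λ v → degree≤3ω v chordal clawFree ω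

proposition29 : (G : Graph) → Chordal G → ClawFree G →
    ProperOrientationNumber≤ G (maxDegree G) ×
    (∀ w → IsCliqueNumber G w → maxDegree G ≤ 3 * w)
proposition29 G chordal clawFree =
  properOrientationNumber≤maxDegree , λ w → maxDegree≤3ω chordal clawFree
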